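{- $\mathfrak{ss}_n=3$.
   Context: Let $\mathfrak S$ be the set of sequences $\boldsymbol a=\langle a_i:i\in\omega\rangle$ of rational numbers with $a_i\to 0$. For infinite $X\subseteq\omega$ with increasing enumeration $\langle i_n:n\in\omega\rangle$, $\sum_X\boldsymbol a$ denotes the series $\sum_{n}a_{i_n}$. A series is conditional if the sum of its positive terms is $+\infty$ and the sum of its negative terms is $-\infty$; it is conditionally convergent if it converges to a real number and is conditional. $\mathfrak S_{cc}$ is the set of $\boldsymbol a\in\mathfrak S$ with $\sum_\omega\boldsymbol a$ conditionally convergent; $[\omega]^\omega_\omega$ is the set of infinite coinfinite subsets of $\omega$. $\mathfrak{ss}_n$ is the least cardinality of a family $\mathcal X\subseteq[\omega]^\omega_\omega$ such that for every $\boldsymbol a\in\mathfrak S_{cc}$ there is $X\in\mathcal X$ with $\sum_X\boldsymbol a$ conditional. -}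

module Defs where

open import Data.Nat using (ℕ; zero; suc; _≤_)
import Data.Nat as N
open import Data.Fin using (Fin)
open import Data.Rational using (ℚ; 0ℚ; _+_; _-_; _<_; _⊔_; _⊓_; ∣_∣)
open import Data.Product using (Σ; ∃; _×_; _,_; proj₁)
open import Relation.Binary.PropositionalEquality using (_≢_)

Seq : Set
Seq = ℕ → ℚ

psum : Seq → ℕ → ℚ
psum b zero    = 0ℚ
psum b (suc n) = psum b n + b n

TendsToZero : Seq → Set
TendsToZero a = ∀ (ε : ℚ) → 0ℚ < ε → ∃ λ N → ∀ n → N ≤ n → ∣ a n ∣ < ε

-- The series Σ b converges to a real number  ⇔  its partial sums are Cauchy in ℚ.
Converges : Seq → Set
Converges b = ∀ (ε : ℚ) → 0ℚ < ε →
  ∃ λ N → ∀ m n → N ≤ m → N ≤ n → ∣ psum b m - psum b n ∣ < ε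

Conditional : Seq → Set
Conditional b =
  (∀ (B : ℚ) → ∃ λ N → B < psum (λ i → b i ⊔ 0ℚ) N) ×
  (∀ (B : ℚ) → ∃ λ N → psum (λ i → b i ⊓ 0ℚ) N < B)

ConditionallyConvergent : Seq → Set
ConditionallyConvergent b = Converges b × Conditional b

InScc : Seq → Set
InScc a = TendsToZero a × ConditionallyConvergent a

-- An infinite subset X ⊆ ω is represented by its increasing enumeration e = ⟨i_n⟩.
StrictlyIncreasing : (ℕ → ℕ) → Set
StrictlyIncreasing e = ∀ n → e n N.< e (suc n)

Coinfinite : (ℕ → ℕ) → Set
Coinfinite e = ∀ n → ∃ λ m → n ≤ m × (∀ k → e k ≢ m)

InfCoinf : Set
InfCoinf = Σ (ℕ → ℕ) λ e → StrictlyIncreasing e × Coinfinite e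

subseries : Seq → InfCoinf → Seq
subseries a X n = a (proj₁ X n)

-- A family of k sets in [ω]^ω_ω (possibly with repetitions, so of cardinality ≤ k)
-- witnessing the defining property of 𝔰𝔰_n.
Works : ℕ → Set
Works k = Σ (Fin k → InfCoinf) λ F →
  ∀ (a : Seq) → InScc a → ∃ λ (i : Fin k) → Conditional (subseries a (F i))

ssn≡ : ℕ → Set
ssn≡ n = Works n × (∀ k → Works k → n ≤ k)

{-# OPTIONS --safe #-}
-- Three sets suffice: split ω into its residue classes mod 3.  If Σ a is conditionally
-- convergent, excluded middle yields a class along which the positive terms of a sum to +∞
-- and a class along which the negative terms sum to −∞.  Both classes lie in one of the three
-- sets ω ∖ (r + 3ℕ), along which Σ a is therefore conditional.
--
-- Two sets never suffice: given X and Y, build a series whose positive terms sit outside Y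
-- and whose negative terms sit outside X (both complements are infinite).  Level m of the
-- series consists of m + 1 pairs ±1/(m+1), each term placed at the next admissible index, so
-- the partial sums stay in [0, 1/(m+1)] while every level adds 1 to both the positive and the
-- negative part.  The series is conditionally convergent, yet Σ_X a has no negative and Σ_Y a
-- no positive terms.

module Submission where

open import Defs
open import Axiom.ExcludedMiddle using (ExcludedMiddle)
open import Level using (0ℓ)

open import Data.Bool using (Bool; true; false; not)
open import Data.Empty using (⊥; ⊥-elim)
open import Data.Fin using (Fin; zero; suc; toℕ)
open import Data.Integer as ℤ using (+[1+_]; -[1+_])
import Data.Integer.Properties as ℤ
open import Data.Nat as ℕ using (ℕ; zero; suc; z≤n; s≤s; z<s; s<s; _≤‴_; ≤‴-refl; ≤‴-step)
import Data.Nat.Properties as ℕ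
open import Algebra.Properties.CommutativeSemigroup ℕ.+-commutativeSemigroup using (x∙yz≈y∙xz)
open import Data.Nat.DivMod using (_%_; [m+kn]%n≡m%n)
import Data.Nat.Coprimality as Coprime
open import Data.Product using (∃; _×_; _,_; proj₁; proj₂)
open import Data.Rational
  using (ℚ; mkℚ; 0ℚ; 1ℚ; _+_; _*_; -_; _-_; 1/_; _⊔_; _⊓_; ∣_∣; _≤_; _<_; *≤*; *<*)
open import Data.Rational.Properties
open import Data.Rational.Solver using (module +-*-Solver)
open import Data.Rational.Unnormalised as ℚᵘ using (*≡*)
import Data.Rational.Unnormalised.Properties as ℚᵘ
open import Data.Sum using (_⊎_; inj₁; inj₂; [_,_])
open import Function using (_∘_; id)
open import Relation.Binary.Bundles using (Preorder; TotalPreorder)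
open import Relation.Binary.PropositionalEquality
  using (_≡_; _≢_; refl; sym; trans; cong; cong₂; subst; subst₂; module ≡-Reasoning)
open import Relation.Nullary using (¬_; yes; no; does)

open import Algebra.Properties.Group +-0-group using () renaming (⁻¹-involutive to neg-involutive)

open +-*-Solver using (solve; _:+_; _:*_; :-_; _:=_; con)

fromℕ : ℕ → ℚ
fromℕ n = mkℚ (ℤ.+ n) 0 (Coprime.sym (Coprime.1-coprimeTo n))

1/[1+_] : ℕ → ℚ
1/[1+ m ] = 1/ fromℕ (suc m)

fromℕ-suc : ∀ n → fromℕ (suc n) ≡ fromℕ n + 1ℚ
fromℕ-suc n = sym (toℚᵘ-injective (ℚᵘ.≃-trans (toℚᵘ-homo-+ (fromℕ n) 1ℚ) (*≡* numerators)))
  where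
  open ≡-Reasoning
  open import Data.Integer using (+_)
  numerators : (+ n ℤ.* + 1 ℤ.+ + 1 ℤ.* + 1) ℤ.* + 1 ≡ + suc n ℤ.* (+ 1 ℤ.* + 1)
  numerators = begin
    (+ n ℤ.* + 1 ℤ.+ + 1) ℤ.* + 1 ≡⟨ ℤ.*-identityʳ _ ⟩
    + n ℤ.* + 1 ℤ.+ + 1           ≡⟨ cong (ℤ._+ + 1) (ℤ.*-identityʳ (+ n)) ⟩
    + n ℤ.+ + 1                   ≡⟨ ℤ.+-comm (+ n) (+ 1) ⟩
    + suc n                       ≡⟨ ℤ.*-identityʳ _ ⟨
    + suc n ℤ.* + 1               ∎

fromℕ-mono-≤ : ∀ {m n} → m ℕ.≤ n → fromℕ m ≤ fromℕ n
fromℕ-mono-≤ m≤n =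
  *≤* (subst₂ ℤ._≤_ (sym (ℤ.*-identityʳ _)) (sym (ℤ.*-identityʳ _)) (ℤ.+≤+ m≤n))

fromℕ-unbounded : ∀ p → ∃ λ k → p < fromℕ k
fromℕ-unbounded (mkℚ (ℤ.+ n) d _) =
  suc n , *<* (subst₂ ℤ._<_ (sym (ℤ.*-identityʳ (ℤ.+ n))) (ℤ.pos-* (suc n) (suc d))
                 (ℤ.+<+ (ℕ.<-≤-trans (ℕ.n<1+n n) (ℕ.m≤m*n (suc n) (suc d)))))
fromℕ-unbounded (mkℚ -[1+ n ] d _) = 0 , *<* ℤ.-<+

fromℕ*1/[1+]≡1 : ∀ m → fromℕ (suc m) * 1/[1+ m ] ≡ 1ℚ
fromℕ*1/[1+]≡1 m = *-inverseʳ (fromℕ (suc m))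

1/[1+]-nonneg : ∀ m → 0ℚ ≤ 1/[1+ m ]
1/[1+]-nonneg m = nonNegative⁻¹ 1/[1+ m ]

1/[1+]-antimono-≤ : ∀ {k m} → k ℕ.≤ m → 1/[1+ m ] ≤ 1/[1+ k ]
1/[1+]-antimono-≤ k≤m =
  *≤* (subst₂ ℤ._≤_ (sym (ℤ.*-identityˡ _)) (sym (ℤ.*-identityˡ _)) (ℤ.+≤+ (s≤s k≤m)))

1/[1+]-arbitrarilySmall : ∀ ε → 0ℚ < ε → ∃ λ m → 1/[1+ m ] < ε
1/[1+]-arbitrarilySmall (mkℚ +[1+ n ] d _) _ =
  suc d , *<* (subst₂ ℤ._<_ (sym (ℤ.*-identityˡ _)) refl
                 (ℤ.+<+ (ℕ.<-≤-trans (ℕ.n<1+n (suc d)) (ℕ.m≤n*m (suc (suc d)) (suc n)))))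
1/[1+]-arbitrarilySmall (mkℚ (ℤ.+ 0) d _) (*<* (ℤ.+<+ ()))
1/[1+]-arbitrarilySmall (mkℚ -[1+ n ] d _) (*<* ())

p≤p+q : ∀ p {q} → 0ℚ ≤ q → p ≤ p + q
p≤p+q p 0≤q = ≤-trans (≤-reflexive (sym (+-identityʳ p))) (+-monoʳ-≤ p 0≤q)

p-q≤p : ∀ p {q} → 0ℚ ≤ q → p - q ≤ p
p-q≤p p 0≤q = ≤-trans (+-monoʳ-≤ p (neg-antimono-≤ 0≤q)) (≤-reflexive (+-identityʳ p))

∣p-q∣≤r : ∀ {p q r} → 0ℚ ≤ p → p ≤ r → 0ℚ ≤ q → q ≤ r → ∣ p - q ∣ ≤ r
∣p-q∣≤r {p} {q} 0≤p p≤r 0≤q q≤r with ∣p∣≡p∨∣p∣≡-p (p - q)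
... | inj₁ ∣p-q∣≡p-q = ≤-trans (≤-reflexive ∣p-q∣≡p-q) (≤-trans (p-q≤p p 0≤q) p≤r)
... | inj₂ ∣p-q∣≡-[p-q] =
  ≤-trans (≤-reflexive (trans ∣p-q∣≡-[p-q] (-[p-q]≡q-p p q))) (≤-trans (p-q≤p q 0≤p) q≤r)
  where
  -[p-q]≡q-p : ∀ p q → - (p - q) ≡ q - p
  -[p-q]≡q-p = solve 2 (λ p q → :- (p :+ :- q) := q :+ :- p) refl

_⁺ _⁻ : Seq → Seq
(b ⁺) i = b i ⊔ 0ℚ
(b ⁻) i = b i ⊓ 0ℚ

SumsTo+∞ SumsTo-∞ BoundedAbove : Seq → Set
SumsTo+∞ g = ∀ B → ∃ λ N → B < psum g N
SumsTo-∞ g = ∀ B → ∃ λ N → psum g N < B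
BoundedAbove g = ∃ λ B → ∀ N → psum g N ≤ B

stepwise⇒monotone : ∀ {a ℓ₁ ℓ₂} (P : Preorder a ℓ₁ ℓ₂) (f : ℕ → Preorder.Carrier P) →
                    (∀ n → Preorder._≲_ P (f n) (f (suc n))) →
                    ∀ {m n} → m ℕ.≤ n → Preorder._≲_ P (f m) (f n)
stepwise⇒monotone P f f≲f∘suc m≤n = go (ℕ.≤⇒≤‴ m≤n)
  where
  go : ∀ {m n} → m ≤‴ n → Preorder._≲_ P (f m) (f n)
  go ≤‴-refl       = Preorder.refl P
  go (≤‴-step m<n) = Preorder.trans P (f≲f∘suc _) (go m<n)

psum-mono-≤ : ∀ {g} → (∀ i → 0ℚ ≤ g i) → ∀ {M N} → M ℕ.≤ N → psum g M ≤ psum g N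
psum-mono-≤ {g} g≥0 = stepwise⇒monotone (TotalPreorder.preorder ≤-totalPreorder) (psum g)
  (λ n → p≤p+q (psum g n) (g≥0 n))

psum-nonneg : ∀ {g} → (∀ i → 0ℚ ≤ g i) → ∀ N → 0ℚ ≤ psum g N
psum-nonneg g≥0 N = psum-mono-≤ g≥0 {0} {N} z≤n

psum-zero : ∀ {g} → (∀ i → g i ≡ 0ℚ) → ∀ N → psum g N ≡ 0ℚ
psum-zero g≡0 zero    = refl
psum-zero g≡0 (suc N) = trans (cong₂ _+_ (psum-zero g≡0 N) (g≡0 N)) (+-identityʳ 0ℚ)

psum-neg : ∀ g N → psum (-_ ∘ g) N ≡ - psum g N
psum-neg g zero    = refl
psum-neg g (suc N) = trans (cong (_+ - g N) (psum-neg g N)) (sym (neg-distrib-+ (psum g N) (g N)))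

SumsTo-∞⇒neg-SumsTo+∞ : ∀ {g} → SumsTo-∞ g → SumsTo+∞ (-_ ∘ g)
SumsTo-∞⇒neg-SumsTo+∞ {g} g→-∞ B =
  let N , lt = g→-∞ (- B) in
  N , subst₂ _<_ (neg-involutive B) (sym (psum-neg g N)) (neg-antimono-< lt)

neg-SumsTo+∞⇒SumsTo-∞ : ∀ {g} → SumsTo+∞ (-_ ∘ g) → SumsTo-∞ g
neg-SumsTo+∞⇒SumsTo-∞ {g} -g→∞ B =
  let N , lt = -g→∞ (- B) in
  N , subst₂ _<_ (neg-involutive (psum g N)) (neg-involutive B)
        (neg-antimono-< (subst (- B <_) (psum-neg g N) lt))

SumsTo+∞⇒¬BoundedAbove : ∀ {g} → SumsTo+∞ g → ¬ BoundedAbove g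
SumsTo+∞⇒¬BoundedAbove g→∞ (B , bound) =
  let N , B<sum = g→∞ B in <-irrefl refl (<-≤-trans B<sum (bound N))

SumsTo+∞-or-BoundedAbove : ExcludedMiddle 0ℓ → ∀ g → SumsTo+∞ g ⊎ BoundedAbove g
SumsTo+∞-or-BoundedAbove em g with em {BoundedAbove g}
... | yes bounded = inj₂ bounded
... | no unbounded = inj₁ λ B → exceeds B
  where
  exceeds : ∀ B → ∃ λ N → B < psum g N
  exceeds B with em {∃ λ N → B < psum g N}
  ... | yes B<sum = B<sum
  ... | no ¬B<sum = ⊥-elim (unbounded (B , λ N → ≮⇒≥ (λ B<sumN → ¬B<sum (N , B<sumN))))

nonneg⇒¬Conditional : ∀ {b} → (∀ i → 0ℚ ≤ b i) → ¬ Conditional b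
nonneg⇒¬Conditional b≥0 (_ , b⁻→-∞) =
  let N , lt = b⁻→-∞ 0ℚ in <-irrefl (psum-zero (λ i → p≥q⇒p⊓q≡q (b≥0 i)) N) lt

nonpos⇒¬Conditional : ∀ {b} → (∀ i → b i ≤ 0ℚ) → ¬ Conditional b
nonpos⇒¬Conditional b≤0 (b⁺→∞ , _) =
  let N , lt = b⁺→∞ 0ℚ in <-irrefl (sym (psum-zero (λ i → p≤q⇒p⊔q≡q (b≤0 i)) N)) lt

-- Three sets suffice

residueClass : Seq → ℕ → Seq
residueClass g r k = g (r ℕ.+ k ℕ.* 3)

psum-residueClasses : ∀ g K → psum g (K ℕ.* 3) ≡
  psum (residueClass g 0) K + psum (residueClass g 1) K + psum (residueClass g 2) K
psum-residueClasses g zero    = refl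
psum-residueClasses g (suc K) rewrite psum-residueClasses g K =
  solve 6 (λ a b c x y z → a :+ b :+ c :+ x :+ y :+ z := (a :+ x) :+ (b :+ y) :+ (c :+ z)) refl
    (psum (residueClass g 0) K) (psum (residueClass g 1) K) (psum (residueClass g 2) K)
    (g (K ℕ.* 3)) (g (1 ℕ.+ K ℕ.* 3)) (g (2 ℕ.+ K ℕ.* 3))

someResidueClass-SumsTo+∞ : ExcludedMiddle 0ℓ → ∀ {g} → (∀ i → 0ℚ ≤ g i) → SumsTo+∞ g →
                            ∃ λ (r : Fin 3) → SumsTo+∞ (residueClass g (toℕ r))
someResidueClass-SumsTo+∞ em {g} g≥0 g→∞
  with SumsTo+∞-or-BoundedAbove em (residueClass g 0)
     | SumsTo+∞-or-BoundedAbove em (residueClass g 1)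
     | SumsTo+∞-or-BoundedAbove em (residueClass g 2)
... | inj₁ g₀→∞ | _         | _         = zero , g₀→∞
... | inj₂ _    | inj₁ g₁→∞ | _         = suc zero , g₁→∞
... | inj₂ _    | inj₂ _    | inj₁ g₂→∞ = suc (suc zero) , g₂→∞
... | inj₂ (B₀ , ≤B₀) | inj₂ (B₁ , ≤B₁) | inj₂ (B₂ , ≤B₂) =
  ⊥-elim (SumsTo+∞⇒¬BoundedAbove g→∞ (B₀ + B₁ + B₂ , λ N → begin
    psum g N                                       ≤⟨ psum-mono-≤ g≥0 (ℕ.m≤m*n N 3) ⟩
    psum g (N ℕ.* 3)                               ≡⟨ psum-residueClasses g N ⟩
    psum (residueClass g 0) N + psum (residueClass g 1) N + psum (residueClass g 2) N
                                                   ≤⟨ +-mono-≤ (+-mono-≤ (≤B₀ N) (≤B₁ N)) (≤B₂ N) ⟩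
    B₀ + B₁ + B₂                                   ∎))
  where open ≤-Reasoning

interleave : ℕ → ℕ → ℕ → ℕ
interleave x y zero          = x
interleave x y (suc zero)    = y
interleave x y (suc (suc n)) = 3 ℕ.+ interleave x y n

interleave-even : ∀ x y K → interleave x y (K ℕ.* 2) ≡ x ℕ.+ K ℕ.* 3
interleave-even x y zero    = sym (ℕ.+-identityʳ x)
interleave-even x y (suc K) = trans (cong (3 ℕ.+_) (interleave-even x y K)) (x∙yz≈y∙xz 3 x (K ℕ.* 3))

interleave-odd : ∀ x y K → interleave x y (suc (K ℕ.* 2)) ≡ y ℕ.+ K ℕ.* 3
interleave-odd x y zero    = sym (ℕ.+-identityʳ y)
interleave-odd x y (suc K) = trans (cong (3 ℕ.+_) (interleave-odd x y K)) (x∙yz≈y∙xz 3 y (K ℕ.* 3))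

psum-interleave : ∀ g x y K →
  psum (g ∘ interleave x y) (K ℕ.* 2) ≡ psum (residueClass g x) K + psum (residueClass g y) K
psum-interleave g x y zero = refl
psum-interleave g x y (suc K)
  rewrite psum-interleave g x y K | interleave-even x y K | interleave-odd x y K =
  solve 4 (λ a b u v → a :+ b :+ u :+ v := (a :+ u) :+ (b :+ v)) refl
    (psum (residueClass g x) K) (psum (residueClass g y) K) (g (x ℕ.+ K ℕ.* 3)) (g (y ℕ.+ K ℕ.* 3))

_∈₂_ : ℕ → ℕ × ℕ → Set
c ∈₂ (x , y) = c ≡ x ⊎ c ≡ y

interleave-SumsTo+∞ : ∀ {g} → (∀ i → 0ℚ ≤ g i) → ∀ {c x y} → c ∈₂ (x , y) →
                      SumsTo+∞ (residueClass g c) → SumsTo+∞ (g ∘ interleave x y)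
interleave-SumsTo+∞ {g} g≥0 {x = x} {y} (inj₁ refl) gₓ→∞ B =
  let N , lt = gₓ→∞ B in
  N ℕ.* 2 , <-≤-trans lt (begin
    psum (residueClass g x) N                             ≤⟨ p≤p+q _ (psum-nonneg (g≥0 ∘ _) N) ⟩
    psum (residueClass g x) N + psum (residueClass g y) N ≡⟨ psum-interleave g x y N ⟨
    psum (g ∘ interleave x y) (N ℕ.* 2)                   ∎)
  where open ≤-Reasoning
interleave-SumsTo+∞ {g} g≥0 {x = x} {y} (inj₂ refl) gᵧ→∞ B =
  let N , lt = gᵧ→∞ B in
  N ℕ.* 2 , <-≤-trans lt (begin
    psum (residueClass g y) N                             ≤⟨ p≤p+q _ (psum-nonneg (g≥0 ∘ _) N) ⟩
    psum (residueClass g y) N + psum (residueClass g x) N ≡⟨ +-comm (psum (residueClass g y) N) _ ⟩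
    psum (residueClass g x) N + psum (residueClass g y) N ≡⟨ psum-interleave g x y N ⟨
    psum (g ∘ interleave x y) (N ℕ.* 2)                   ∎)
  where open ≤-Reasoning

interleave-increasing : ∀ {x y} → x ℕ.< y → y ℕ.< 3 ℕ.+ x → StrictlyIncreasing (interleave x y)
interleave-increasing x<y y<3+x zero          = x<y
interleave-increasing x<y y<3+x (suc zero)    = y<3+x
interleave-increasing x<y y<3+x (suc (suc n)) = s<s (s<s (s<s (interleave-increasing x<y y<3+x n)))

interleave-mod3 : ∀ x y k → interleave x y k % 3 ≡ x % 3 ⊎ interleave x y k % 3 ≡ y % 3
interleave-mod3 x y zero          = inj₁ refl
interleave-mod3 x y (suc zero)    = inj₂ refl
interleave-mod3 x y (suc (suc k)) = interleave-mod3 x y k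

interleave-coinfinite : ∀ {x y} z → z % 3 ≢ x % 3 → z % 3 ≢ y % 3 → Coinfinite (interleave x y)
interleave-coinfinite {x} {y} z z≢x z≢y n =
  z ℕ.+ n ℕ.* 3 , ℕ.≤-trans (ℕ.m≤m*n n 3) (ℕ.m≤n+m _ z) , missed
  where
  missed : ∀ k → interleave x y k ≢ z ℕ.+ n ℕ.* 3
  missed k eq = [ z≢x ∘ trans z≡ , z≢y ∘ trans z≡ ] (interleave-mod3 x y k)
    where
    z≡ : z % 3 ≡ interleave x y k % 3
    z≡ = trans (sym ([m+kn]%n≡m%n z n 3)) (cong (_% 3) (sym eq))

otherResidues : Fin 3 → ℕ × ℕ
otherResidues zero             = 1 , 2
otherResidues (suc zero)       = 0 , 2
otherResidues (suc (suc zero)) = 0 , 1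

interleave-otherResidues : ∀ r → let (x , y) = otherResidues r in
                           StrictlyIncreasing (interleave x y) × Coinfinite (interleave x y)
interleave-otherResidues zero =
  interleave-increasing (s<s z<s) (s<s (s<s z<s)) , interleave-coinfinite 0 (λ ()) (λ ())
interleave-otherResidues (suc zero) =
  interleave-increasing z<s (s<s (s<s z<s)) , interleave-coinfinite 1 (λ ()) (λ ())
interleave-otherResidues (suc (suc zero)) =
  interleave-increasing z<s (s<s z<s) , interleave-coinfinite 2 (λ ()) (λ ())

avoiding : Fin 3 → InfCoinf
avoiding r = interleave (proj₁ (otherResidues r)) (proj₂ (otherResidues r)) , interleave-otherResidues r

otherResidues-cover : ∀ (i j : Fin 3) → ∃ λ r → toℕ i ∈₂ otherResidues r × toℕ j ∈₂ otherResidues r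
otherResidues-cover zero             zero             = suc zero , inj₁ refl , inj₁ refl
otherResidues-cover zero             (suc zero)       = suc (suc zero) , inj₁ refl , inj₂ refl
otherResidues-cover zero             (suc (suc zero)) = suc zero , inj₁ refl , inj₂ refl
otherResidues-cover (suc zero)       zero             = suc (suc zero) , inj₂ refl , inj₁ refl
otherResidues-cover (suc zero)       (suc zero)       = zero , inj₁ refl , inj₁ refl
otherResidues-cover (suc zero)       (suc (suc zero)) = zero , inj₁ refl , inj₂ refl
otherResidues-cover (suc (suc zero)) zero             = suc zero , inj₂ refl , inj₁ refl
otherResidues-cover (suc (suc zero)) (suc zero)       = zero , inj₂ refl , inj₁ refl
otherResidues-cover (suc (suc zero)) (suc (suc zero)) = zero , inj₂ refl , inj₂ refl

avoiding-works : ExcludedMiddle 0ℓ → Works 3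
avoiding-works em = avoiding , λ a (_ , _ , a⁺→∞ , a⁻→-∞) →
  let a⁺≥0 : ∀ n → 0ℚ ≤ (a ⁺) n
      a⁺≥0 n = p≤q⊔p (a n) 0ℚ
      -a⁻≥0 : ∀ n → 0ℚ ≤ - (a ⁻) n
      -a⁻≥0 n = neg-antimono-≤ (p⊓q≤q (a n) 0ℚ)
      i , classᵢ→∞ = someResidueClass-SumsTo+∞ em {a ⁺} a⁺≥0 a⁺→∞
      j , classⱼ→∞ = someResidueClass-SumsTo+∞ em { -_ ∘ a ⁻} -a⁻≥0 (SumsTo-∞⇒neg-SumsTo+∞ a⁻→-∞)
      r , i∈r , j∈r = otherResidues-cover i j
  in r , interleave-SumsTo+∞ a⁺≥0 i∈r classᵢ→∞
       , neg-SumsTo+∞⇒SumsTo-∞ (interleave-SumsTo+∞ -a⁻≥0 j∈r classⱼ→∞)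

-- A series with prescribed sign positions

Infinite : (ℕ → Bool) → Set
Infinite p = ∀ n → ∃ λ m → n ℕ.≤ m × p m ≡ true

data Turn : Set where
  plus minus : Turn

-- ⟨ m , j , t ⟩: pairs 0 … j − 1 of level m are complete, and the t-signed term of pair j
-- is the next one to be placed.
record State : Set where
  constructor ⟨_,_,_⟩
  field
    level : ℕ
    done  : ℕ
    turn  : Turn
open State

closePair : ℕ → ℕ → State
closePair m j with j ℕ.≟ m
... | yes _ = ⟨ suc m , 0 , plus ⟩
... | no _  = ⟨ m , suc j , plus ⟩

advance : State → State
advance ⟨ m , j , plus ⟩  = ⟨ m , j , minus ⟩
advance ⟨ m , j , minus ⟩ = closePair m j

term : State → ℚ
term ⟨ m , _ , plus ⟩  = 1/[1+ m ]
term ⟨ m , _ , minus ⟩ = - 1/[1+ m ]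

step : State → Bool → State
step s true  = advance s
step s false = s

emit : State → Bool → ℚ
emit s true  = term s
emit s false = 0ℚ

-- The positive, and also the negative, mass after m complete levels and j pairs of level m.
mass : ℕ → ℕ → ℚ
mass m j = fromℕ m + fromℕ j * 1/[1+ m ]

partialSum gain loss : State → ℚ
partialSum ⟨ _ , _ , plus ⟩  = 0ℚ
partialSum ⟨ m , _ , minus ⟩ = 1/[1+ m ]
gain ⟨ m , j , plus ⟩  = mass m j
gain ⟨ m , j , minus ⟩ = mass m (suc j)
loss ⟨ m , j , _ ⟩ = mass m j

mass-suc : ∀ m j → mass m (suc j) ≡ mass m j + 1/[1+ m ]
mass-suc m j = trans (cong (λ t → fromℕ m + t * 1/[1+ m ]) (fromℕ-suc j))
  (solve 3 (λ a b w → a :+ (b :+ con 1ℚ) :* w := (a :+ b :* w) :+ w) refl (fromℕ m) (fromℕ j) 1/[1+ m ])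

mass-full : ∀ m → mass m (suc m) ≡ mass (suc m) 0
mass-full m = begin
  fromℕ m + fromℕ (suc m) * 1/[1+ m ] ≡⟨ cong (fromℕ m +_) (fromℕ*1/[1+]≡1 m) ⟩
  fromℕ m + 1ℚ                        ≡⟨ fromℕ-suc m ⟨
  fromℕ (suc m)                       ≡⟨ +-identityʳ _ ⟨
  fromℕ (suc m) + 0ℚ                  ≡⟨ cong (fromℕ (suc m) +_) (*-zeroˡ 1/[1+ suc m ]) ⟨
  fromℕ (suc m) + 0ℚ * 1/[1+ suc m ]  ∎
  where open ≡-Reasoning

fromℕ≤mass : ∀ m j → fromℕ m ≤ mass m j
fromℕ≤mass m j =
  p≤p+q (fromℕ m) (nonNegative⁻¹ (fromℕ j * 1/[1+ m ]) {{nonNeg*nonNeg⇒nonNeg (fromℕ j) 1/[1+ m ]}})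

step-additive : (f : State → ℚ) (g : ℚ → ℚ) → g 0ℚ ≡ 0ℚ →
                (∀ s → f (advance s) ≡ f s + g (term s)) →
                ∀ s b → f (step s b) ≡ f s + g (emit s b)
step-additive f g g0≡0 f-advance s true  = f-advance s
step-additive f g g0≡0 f-advance s false = sym (trans (cong (f s +_) g0≡0) (+-identityʳ (f s)))

partialSum-advance : ∀ s → partialSum (advance s) ≡ partialSum s + term s
partialSum-advance ⟨ m , j , plus ⟩ = sym (+-identityˡ _)
partialSum-advance ⟨ m , j , minus ⟩ with j ℕ.≟ m
... | yes _ = sym (+-inverseʳ 1/[1+ m ])
... | no _  = sym (+-inverseʳ 1/[1+ m ])

gain-advance : ∀ s → gain (advance s) ≡ gain s + (term s ⊔ 0ℚ)
gain-advance ⟨ m , j , plus ⟩ =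
  trans (mass-suc m j) (cong (mass m j +_) (sym (p≥q⇒p⊔q≡p (1/[1+]-nonneg m))))
gain-advance ⟨ m , j , minus ⟩ =
  trans (closed m j) (sym (trans (cong (mass m (suc j) +_) (p≤q⇒p⊔q≡q -1/[1+m]≤0)) (+-identityʳ _)))
  where
  -1/[1+m]≤0 : - 1/[1+ m ] ≤ 0ℚ
  -1/[1+m]≤0 = neg-antimono-≤ (1/[1+]-nonneg m)
  closed : ∀ m j → gain (closePair m j) ≡ mass m (suc j)
  closed m j with j ℕ.≟ m
  ... | yes refl = sym (mass-full m)
  ... | no _     = refl

loss-advance : ∀ s → loss (advance s) ≡ loss s + - (term s ⊓ 0ℚ)
loss-advance ⟨ m , j , plus ⟩ =
  sym (trans (cong (λ t → mass m j + - t) (p≥q⇒p⊓q≡q (1/[1+]-nonneg m))) (+-identityʳ _))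
loss-advance ⟨ m , j , minus ⟩ =
  trans (closed m j) (trans (mass-suc m j) (cong (mass m j +_) (sym lossOfTerm)))
  where
  lossOfTerm : - (- 1/[1+ m ] ⊓ 0ℚ) ≡ 1/[1+ m ]
  lossOfTerm = trans (cong -_ (p≤q⇒p⊓q≡p (neg-antimono-≤ (1/[1+]-nonneg m)))) (neg-involutive _)
  closed : ∀ m j → loss (closePair m j) ≡ mass m (suc j)
  closed m j with j ℕ.≟ m
  ... | yes refl = sym (mass-full m)
  ... | no _     = refl

partialSum-bounds : ∀ s → 0ℚ ≤ partialSum s × partialSum s ≤ 1/[1+ level s ]
partialSum-bounds ⟨ m , _ , plus ⟩  = ≤-refl , 1/[1+]-nonneg m
partialSum-bounds ⟨ m , _ , minus ⟩ = 1/[1+]-nonneg m , ≤-refl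

fromℕ≤gain : ∀ s → fromℕ (level s) ≤ gain s
fromℕ≤gain ⟨ m , j , plus ⟩  = fromℕ≤mass m j
fromℕ≤gain ⟨ m , j , minus ⟩ = fromℕ≤mass m (suc j)

∣emit∣≤1/[1+level] : ∀ s b → ∣ emit s b ∣ ≤ 1/[1+ level s ]
∣emit∣≤1/[1+level] ⟨ m , _ , plus ⟩  true  = ≤-reflexive (0≤p⇒∣p∣≡p (1/[1+]-nonneg m))
∣emit∣≤1/[1+level] ⟨ m , _ , minus ⟩ true  =
  ≤-reflexive (trans (∣-p∣≡∣p∣ 1/[1+ m ]) (0≤p⇒∣p∣≡p (1/[1+]-nonneg m)))
∣emit∣≤1/[1+level] s                 false = 1/[1+]-nonneg (level s)

level-step : ∀ s b → level s ℕ.≤ level (step s b)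
level-step ⟨ m , j , plus ⟩  true = ℕ.≤-refl
level-step ⟨ m , j , minus ⟩ true with j ℕ.≟ m
... | yes _ = ℕ.n≤1+n m
... | no _  = ℕ.≤-refl
level-step s false = ℕ.≤-refl

done≤level-step : ∀ s b → done s ℕ.≤ level s → done (step s b) ℕ.≤ level (step s b)
done≤level-step ⟨ m , j , plus ⟩  true j≤m = j≤m
done≤level-step ⟨ m , j , minus ⟩ true j≤m with j ℕ.≟ m
... | yes _   = z≤n
... | no j≢m  = ℕ.≤∧≢⇒< j≤m j≢m
done≤level-step s false j≤m = j≤m

closePair-last : ∀ m → closePair m m ≡ ⟨ suc m , 0 , plus ⟩
closePair-last m with m ℕ.≟ m
... | yes _   = refl
... | no m≢m  = ⊥-elim (m≢m refl)

closePair-inner : ∀ {m j} → j ≢ m → closePair m j ≡ ⟨ m , suc j , plus ⟩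
closePair-inner {m} {j} j≢m with j ℕ.≟ m
... | yes j≡m = ⊥-elim (j≢m j≡m)
... | no _    = refl

module SignSeparated (p q : ℕ → Bool) where

  admissible : Turn → ℕ → Bool
  admissible plus  = p
  admissible minus = q

  state : ℕ → State
  state zero    = ⟨ 0 , 0 , plus ⟩
  state (suc n) = step (state n) (admissible (turn (state n)) n)

  placesAt : ℕ → Bool
  placesAt n = admissible (turn (state n)) n

  series : Seq
  series n = emit (state n) (placesAt n)

  psum-tracks : (f : State → ℚ) (g : ℚ → ℚ) → f (state 0) ≡ 0ℚ → g 0ℚ ≡ 0ℚ →
                (∀ s → f (advance s) ≡ f s + g (term s)) → ∀ n → psum (g ∘ series) n ≡ f (state n)
  psum-tracks f g f₀≡0 g0≡0 f-advance zero    = sym f₀≡0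
  psum-tracks f g f₀≡0 g0≡0 f-advance (suc n) =
    trans (cong (_+ g (series n)) (psum-tracks f g f₀≡0 g0≡0 f-advance n))
          (sym (step-additive f g g0≡0 f-advance (state n) (placesAt n)))

  psum≡partialSum : ∀ n → psum series n ≡ partialSum (state n)
  psum≡partialSum = psum-tracks partialSum id refl refl partialSum-advance

  psum⁺≡gain : ∀ n → psum (series ⁺) n ≡ gain (state n)
  psum⁺≡gain = psum-tracks gain (_⊔ 0ℚ) refl refl gain-advance

  psum-neg⁻≡loss : ∀ n → psum (-_ ∘ series ⁻) n ≡ loss (state n)
  psum-neg⁻≡loss = psum-tracks loss (λ x → - (x ⊓ 0ℚ)) refl refl loss-advance

  series-nonpos-off-p : ∀ i → p i ≡ false → series i ≤ 0ℚ
  series-nonpos-off-p i pᵢ≡false = emit-nonpos (state i)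
    where
    emit-nonpos : ∀ s → emit s (admissible (turn s) i) ≤ 0ℚ
    emit-nonpos ⟨ _ , _ , plus ⟩ rewrite pᵢ≡false = ≤-refl
    emit-nonpos ⟨ m , _ , minus ⟩ with q i
    ... | true  = neg-antimono-≤ (1/[1+]-nonneg m)
    ... | false = ≤-refl

  series-nonneg-off-q : ∀ i → q i ≡ false → 0ℚ ≤ series i
  series-nonneg-off-q i qᵢ≡false = emit-nonneg (state i)
    where
    emit-nonneg : ∀ s → 0ℚ ≤ emit s (admissible (turn s) i)
    emit-nonneg ⟨ m , _ , plus ⟩ with p i
    ... | true  = 1/[1+]-nonneg m
    ... | false = ≤-refl
    emit-nonneg ⟨ _ , _ , minus ⟩ rewrite qᵢ≡false = ≤-refl

  state-suc : ∀ n {s b} → state n ≡ s → admissible (turn s) n ≡ b → state (suc n) ≡ step s b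
  state-suc n refl refl = refl

  advancesBy : ∀ {s n k} → state n ≡ s → n ≤‴ k → admissible (turn s) k ≡ true →
               ∃ λ n' → state n' ≡ advance s
  advancesBy {n = n} sₙ ≤‴-refl admissibleₙ = suc n , state-suc n sₙ admissibleₙ
  advancesBy {s} {n} sₙ (≤‴-step n<k) admissibleₖ with admissible (turn s) n in admissibleₙ
  ... | true  = suc n , state-suc n sₙ admissibleₙ
  ... | false = advancesBy (state-suc n sₙ admissibleₙ) n<k admissibleₖ

  level-mono : ∀ {m n} → m ℕ.≤ n → level (state m) ℕ.≤ level (state n)
  level-mono = stepwise⇒monotone ℕ.≤-preorder (level ∘ state) λ n → level-step (state n) (placesAt n)

  done≤level : ∀ n → done (state n) ℕ.≤ level (state n)
  done≤level zero    = z≤n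
  done≤level (suc n) = done≤level-step (state n) (placesAt n) (done≤level n)

  module Progress (p-infinite : Infinite p) (q-infinite : Infinite q) where

    admissible-infinite : ∀ t → Infinite (admissible t)
    admissible-infinite plus  = p-infinite
    admissible-infinite minus = q-infinite

    eventuallyAdvances : ∀ n {s} → state n ≡ s → ∃ λ n' → state n' ≡ advance s
    eventuallyAdvances n {s} sₙ =
      let k , n≤k , admissibleₖ = admissible-infinite (turn s) n in
      advancesBy sₙ (ℕ.≤⇒≤‴ n≤k) admissibleₖ

    reachesMinus : ∀ n → ∃ λ n' → state n' ≡ ⟨ level (state n) , done (state n) , minus ⟩
    reachesMinus n with state n in sₙ
    ... | ⟨ m , j , plus ⟩  = eventuallyAdvances n sₙ
    ... | ⟨ m , j , minus ⟩ = n , sₙ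

    levelCompletes : ∀ d n {m j} → d ℕ.+ j ≡ m → state n ≡ ⟨ m , j , minus ⟩ →
                     ∃ λ n' → state n' ≡ ⟨ suc m , 0 , plus ⟩
    levelCompletes d n eq sₙ with eventuallyAdvances n sₙ
    levelCompletes zero    _ refl _ | n₁ , s₁ = n₁ , trans s₁ (closePair-last _)
    levelCompletes (suc d) _ refl _ | n₁ , s₁ =
      let n₂ , s₂ = eventuallyAdvances n₁ (trans s₁ (closePair-inner (ℕ.m≢1+n+m _))) in
      levelCompletes d n₂ (ℕ.+-suc d _) s₂

    levelGrows : ∀ n → ∃ λ n' → level (state n) ℕ.< level (state n')
    levelGrows n =
      let n₁ , s₁ = reachesMinus n
          n' , s' = levelCompletes _ n₁ (ℕ.m∸n+n≡m (done≤level n)) s₁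
      in n' , ℕ.≤-reflexive (sym (cong level s'))

    eventuallyLevel≥ : ∀ K → ∃ λ N → ∀ n → N ℕ.≤ n → K ℕ.≤ level (state n)
    eventuallyLevel≥ zero    = 0 , λ _ _ → z≤n
    eventuallyLevel≥ (suc K) =
      let N , K≤level = eventuallyLevel≥ K
          N' , grows = levelGrows N
      in N' , λ n N'≤n → ℕ.<-≤-trans (ℕ.≤-<-trans (K≤level N ℕ.≤-refl) grows) (level-mono N'≤n)

    series→0 : TendsToZero series
    series→0 ε ε>0 =
      let K , 1/[1+K]<ε = 1/[1+]-arbitrarilySmall ε ε>0
          N , K≤level = eventuallyLevel≥ K
      in N , λ n N≤n → ≤-<-trans (≤-trans (∣emit∣≤1/[1+level] (state n) (placesAt n))
                                           (1/[1+]-antimono-≤ (K≤level n N≤n))) 1/[1+K]<ε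

    series-converges : Converges series
    series-converges ε ε>0 =
      let K , 1/[1+K]<ε = 1/[1+]-arbitrarilySmall ε ε>0
          N , K≤level = eventuallyLevel≥ K
          bounds : ∀ n → N ℕ.≤ n → 0ℚ ≤ psum series n × psum series n ≤ 1/[1+ K ]
          bounds n N≤n =
            let 0≤sum , sum≤ = partialSum-bounds (state n) in
            subst (0ℚ ≤_) (sym (psum≡partialSum n)) 0≤sum ,
            subst (_≤ 1/[1+ K ]) (sym (psum≡partialSum n))
                  (≤-trans sum≤ (1/[1+]-antimono-≤ (K≤level n N≤n)))
      in N , λ m n N≤m N≤n →
        let 0≤m , m≤ = bounds m N≤m ; 0≤n , n≤ = bounds n N≤n in
        ≤-<-trans (∣p-q∣≤r 0≤m m≤ 0≤n n≤) 1/[1+K]<ε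

    SumsTo+∞-if-level≤ : ∀ {g} → (∀ n → fromℕ (level (state n)) ≤ psum g n) → SumsTo+∞ g
    SumsTo+∞-if-level≤ level≤psum B =
      let k , B<k = fromℕ-unbounded B
          N , k≤level = eventuallyLevel≥ k
      in N , <-≤-trans B<k (≤-trans (fromℕ-mono-≤ (k≤level N ℕ.≤-refl)) (level≤psum N))

    series⁺→∞ : SumsTo+∞ (series ⁺)
    series⁺→∞ = SumsTo+∞-if-level≤ λ n →
      subst (fromℕ (level (state n)) ≤_) (sym (psum⁺≡gain n)) (fromℕ≤gain (state n))

    series⁻→-∞ : SumsTo-∞ (series ⁻)
    series⁻→-∞ = neg-SumsTo+∞⇒SumsTo-∞ (SumsTo+∞-if-level≤ λ n →
      subst (fromℕ (level (state n)) ≤_) (sym (psum-neg⁻≡loss n))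
            (fromℕ≤mass (level (state n)) (done (state n))))

signSeparatedSeries : ∀ p q → Infinite p → Infinite q →
  ∃ λ a → InScc a × (∀ i → p i ≡ false → a i ≤ 0ℚ) × (∀ i → q i ≡ false → 0ℚ ≤ a i)
signSeparatedSeries p q p-infinite q-infinite =
  series , (series→0 , series-converges , series⁺→∞ , series⁻→-∞)
         , series-nonpos-off-p , series-nonneg-off-q
  where
  open SignSeparated p q
  open Progress p-infinite q-infinite

-- Two sets never suffice

module _ (em : ExcludedMiddle 0ℓ) where

  outside : InfCoinf → ℕ → Bool
  outside (e , _) i = not (does (em {∃ λ k → e k ≡ i}))

  outside-infinite : ∀ X → Infinite (outside X)
  outside-infinite X@(e , _ , coinfinite) n =
    let m , n≤m , missed = coinfinite n in m , n≤m , outside-missed missed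
    where
    outside-missed : ∀ {i} → (∀ k → e k ≢ i) → outside X i ≡ true
    outside-missed {i} missed with em {∃ λ k → e k ≡ i}
    ... | yes (k , eₖ≡i) = ⊥-elim (missed k eₖ≡i)
    ... | no _           = refl

  outside-range : ∀ X k → outside X (proj₁ X k) ≡ false
  outside-range (e , _) k with em {∃ λ j → e j ≡ e k}
  ... | yes _          = refl
  ... | no notInRange  = ⊥-elim (notInRange (k , refl))

  escapesTwoSets : ∀ X Y →
    ∃ λ a → InScc a × ¬ Conditional (subseries a X) × ¬ Conditional (subseries a Y)
  escapesTwoSets X Y =
    let a , a∈Scc , a≤0-off-Y , a≥0-off-X =
          signSeparatedSeries (outside Y) (outside X) (outside-infinite Y) (outside-infinite X)
    in a , a∈Scc , nonneg⇒¬Conditional (λ k → a≥0-off-X _ (outside-range X k))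
                 , nonpos⇒¬Conditional (λ k → a≤0-off-Y _ (outside-range Y k))

  ¬Works-withinTwoSets : ∀ {k} → ((F , _) : Works k) → ∀ X Y → (∀ i → F i ≡ X ⊎ F i ≡ Y) → ⊥
  ¬Works-withinTwoSets (F , works) X Y F⊆XY =
    let a , a∈Scc , ¬X , ¬Y = escapesTwoSets X Y
        i , conditional = works a a∈Scc
        conditionalAt = λ {Z} (Fᵢ≡Z : F i ≡ Z) → subst (Conditional ∘ subseries a) Fᵢ≡Z conditional
    in [ ¬X ∘ conditionalAt , ¬Y ∘ conditionalAt ] (F⊆XY i)

  works⇒3≤ : ∀ k → Works k → 3 ℕ.≤ k
  works⇒3≤ 0 W = ⊥-elim (¬Works-withinTwoSets W (avoiding zero) (avoiding zero) λ ())
  works⇒3≤ 1 W@(F , _) = ⊥-elim (¬Works-withinTwoSets W (F zero) (F zero) λ { zero → inj₁ refl })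
  works⇒3≤ 2 W@(F , _) =
    ⊥-elim (¬Works-withinTwoSets W (F zero) (F (suc zero))
                                 λ { zero → inj₁ refl ; (suc zero) → inj₂ refl })
  works⇒3≤ (suc (suc (suc k))) _ = s≤s (s≤s (s≤s z≤n))

mainTheorem14 : ExcludedMiddle 0ℓ → ssn≡ 3
mainTheorem14 em = avoiding-works em , works⇒3≤ em
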